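{- Let $f$ be a Boolean network of dimension $n$. For all configurations $x,y\in\{0,1\}^n$: (i) $x\to_{a} y$ iff $\mathrm{enc}(x)\Rightarrow_{a}\mathrm{enc}(y)$ in $\mathrm{enc}(f)$ (atomic semantics); (ii) $x\to_{s} y$ iff $\mathrm{enc}(x)\Rightarrow_{ms}\mathrm{enc}(y)$ in $\mathrm{enc}(f)$ (maximal step semantics); (iii) $x\to_{g} y$ iff $\mathrm{enc}(x)\Rightarrow_{st}\mathrm{enc}(y)$ in $\mathrm{enc}(f)$ (step semantics).
   Context: A Boolean network (BN) of dimension $n$ is a tuple $f=\langle f_1,\dots,f_n\rangle$, $f_i:\{0,1\}^n\to\{0,1\}$; $\Delta(x,y)=\{i\mid x_i\neq y_i\}$. Asynchronous: $x\to_a y$ iff $\Delta(x,y)=\{i\}$ for some $i$ and $y_i=f_i(x)$. Synchronous: $x\to_s y$ iff $x\neq y$ and $y_i=f_i(x)$ for all $i$. Generalized asynchronous: $x\to_g y$ iff $x\ne y$ and $y_i=f_i(x)$ for all $i\in\Delta(x,y)$. A Read Petri net (RPN) $(P,T,\mathrm{pre},\mathrm{cont},\mathrm{post},M_0)$ has finite places $P$, transitions $T$, each $t$ with nonempty preset ${}^\bullet t$, context $\underline t\subseteq P\setminus{}^\bullet t$, postset $t^\bullet$. A transition $t$ is enabled in a marking $M\subseteq P$ if ${}^\bullet t\cup\underline t\subseteq M$. Atomic: $M\Rightarrow_a M'$ iff some enabled $t$ gives $M'=(M\setminus{}^\bullet t)\cup t^\bullet$. Step: $M\Rightarrow_{st}M'$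 via a set $S\subseteq T$ iff every $t\in S$ is enabled in $M$, the presets of transitions in $S$ are pairwise disjoint, and $M'=(M\setminus\bigcup_{t\in S}{}^\bullet t)\cup\bigcup_{t\in S}t^\bullet$. Maximal step: $M\Rightarrow_{ms}M'$ via $S$ iff $M\Rightarrow_{st}M'$ via $S$ and no $S'\supsetneq S$ can fire as a step from $M$. Encoding $\mathrm{enc}(f)$: places $\{1,\dots,2n\}$. For each $i$ and each conjunctive clause $C$ (set of literals) of the disjunctive normal form of $\neg x_i\wedge f_i(x)$ there is a transition with preset $\{i\}$, postset $\{i+n\}$, context $\{j\mid\neg x_j\in C,j\neq i\}\cup\{j+n\mid x_j\in C,j\ne i\}$; for each clause $C$ of the DNF of $x_i\wedge\neg f_i(x)$ a transition with preset $\{i+n\}$, postset $\{i\}$ and context of the same form. For $x\in\{0,1\}^n$, $\mathrm{enc}(x)=\{i+nx_i\mid i\in\{1,\dots,n\}\}$. -}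

module Defs where

open import Level using (0ℓ)
open import Data.Bool using (Bool; true; false; not)
open import Data.Fin using (Fin)
open import Data.Nat using (ℕ)
open import Data.Product using (Σ; ∃; _×_; _,_; proj₁; proj₂)
open import Data.Sum using (_⊎_)
open import Data.Empty using (⊥)
open import Data.List using (List; length; lookup)
open import Data.List.Relation.Unary.All using (All)
open import Data.List.Relation.Unary.Any using (Any)
open import Data.List.Membership.Propositional using (_∈_)
open import Relation.Nullary using (¬_)
open import Relation.Binary.PropositionalEquality using (_≡_; _≢_)
open import Function.Bundles using (_⇔_)

-- configurations x ∈ {0,1}^n  (false = 0, true = 1)
Config : ℕ → Set
Config n = Fin n → Bool

BN : ℕ → Set
BN n = Fin n → Config n → Bool

_∈Δ_,_ : ∀ {n} → Fin n → Config n → Config n → Set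
i ∈Δ x , y = x i ≢ y i

_≠ᶜ_ : ∀ {n} → Config n → Config n → Set
x ≠ᶜ y = ¬ (∀ i → x i ≡ y i)

AsyncStep : ∀ {n} → BN n → Config n → Config n → Set
AsyncStep f x y =
  ∃ λ i → (i ∈Δ x , y) × (∀ j → j ∈Δ x , y → j ≡ i) × (y i ≡ f i x)

SyncStep : ∀ {n} → BN n → Config n → Config n → Set
SyncStep f x y = (x ≠ᶜ y) × (∀ i → y i ≡ f i x)

GenStep : ∀ {n} → BN n → Config n → Config n → Set
GenStep f x y = (x ≠ᶜ y) × (∀ i → i ∈Δ x , y → y i ≡ f i x)

-- Subsets (of places / transitions) are predicates.
record RPN : Set₁ where
  field
    Pl   : Set
    Tr   : Set
    pre  : Tr → Pl → Set
    cont : Tr → Pl → Set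
    post : Tr → Pl → Set

module _ (N : RPN) where
  open RPN N

  Marking : Set₁
  Marking = Pl → Set

  _≐_ : Marking → Marking → Set
  M ≐ M' = ∀ p → M p ⇔ M' p

  Enabled : Marking → Tr → Set
  Enabled M t = ∀ p → pre t p ⊎ cont t p → M p

  AtomicStep : Marking → Marking → Set
  AtomicStep M M' =
    ∃ λ t → Enabled M t × (M' ≐ λ p → (M p × ¬ pre t p) ⊎ post t p)

  StepVia : Marking → (Tr → Set) → Marking → Set
  StepVia M S M' =
      (∃ λ t → S t)
    × (∀ t → S t → Enabled M t)
    × (∀ t u → S t → S u → t ≢ u → ∀ p → pre t p → pre u p → ⊥)
    × (M' ≐ λ p → (M p × ¬ (∃ λ t → S t × pre t p))
                    ⊎ (∃ λ t → S t × post t p))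

  Step : Marking → Marking → Set₁
  Step M M' = ∃ λ (S : Tr → Set) → StepVia M S M'

  MaxStep : Marking → Marking → Set₁
  MaxStep M M' = ∃ λ (S : Tr → Set) → StepVia M S M' ×
    ¬ (∃ λ (S' : Tr → Set) → (∀ t → S t → S' t) × (∃ λ t → S' t × ¬ S t)
         × (∃ λ (M'' : Marking) → StepVia M S' M''))

-- literal (j , true) is x_j, literal (j , false) is ¬x_j
Literal : ℕ → Set
Literal n = Fin n × Bool

Clause : ℕ → Set
Clause n = List (Literal n)

DNF : ℕ → Set
DNF n = List (Clause n)

SatLit : ∀ {n} → Config n → Literal n → Set
SatLit x (j , c) = x j ≡ c

SatClause : ∀ {n} → Config n → Clause n → Set
SatClause x C = All (SatLit x) C

SatDNF : ∀ {n} → Config n → DNF n → Set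
SatDNF x D = Any (SatClause x) D

ConsistentClause : ∀ {n} → Clause n → Set
ConsistentClause C = ∀ j → (j , true) ∈ C → (j , false) ∈ C → ⊥

-- dnf i false is a DNF of  ¬x_i ∧ f_i(x),  dnf i true is a DNF of  x_i ∧ ¬f_i(x)
-- (uniformly: dnf i b is a DNF of  x_i = b ∧ f_i(x) ≠ b)
IsDNFChoice : ∀ {n} → BN n → (Fin n → Bool → DNF n) → Set
IsDNFChoice {n} f dnf =
    (∀ i b (x : Config n) → SatDNF x (dnf i b) ⇔ (x i ≡ b × f i x ≢ b))
  × (∀ i b → All ConsistentClause (dnf i b))

-- place (i , false) is place i, place (i , true) is place i+n
Place : ℕ → Set
Place n = Fin n × Bool

-- a transition: variable i, current value b, index of a clause of dnf i b
EncTr : ∀ {n} → (Fin n → Bool → DNF n) → Set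
EncTr {n} dnf = Σ (Fin n × Bool) λ ib → Fin (length (dnf (proj₁ ib) (proj₂ ib)))

encClause : ∀ {n} {dnf : Fin n → Bool → DNF n} → EncTr dnf → Clause n
encClause {dnf = dnf} ((i , b) , k) = lookup (dnf i b) k

-- enc(f), given the chosen DNFs.  Literal ¬x_j ↦ place j = (j,false),
-- literal x_j ↦ place j+n = (j,true).
encNet : ∀ {n} → BN n → (Fin n → Bool → DNF n) → RPN
encNet {n} f dnf = record
  { Pl   = Place n
  ; Tr   = EncTr dnf
  ; pre  = λ t p → p ≡ proj₁ t
  ; cont = λ t p → (proj₁ p ≢ proj₁ (proj₁ t)) × (p ∈ encClause {dnf = dnf} t)
  ; post = λ t p → p ≡ (proj₁ (proj₁ t) , not (proj₂ (proj₁ t)))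
  }

-- enc(x) = { i + n·x_i }
encConfig : ∀ {n} → Config n → Place n → Set
encConfig x p = x (proj₁ p) ≡ proj₂ p

module Submission where

-- The encoding enc(f) has one transition per (variable i, current value b,
-- clause k of the DNF of  x_i = b ∧ f_i(x) ≠ b);  it moves the token of
-- variable i from place (i,b) to place (i,¬b).  The proof rests on three facts.
--
--  * Enabledness: a transition t = ((i,b),k) is enabled in enc(x) iff x_i = b
--    and x satisfies clause k.  (The context omits literals on x_i itself;
--    such a literal can only be x_i = b, since flipping x_i would otherwise
--    satisfy the clause while x_i ≠ b.)  Hence enabled transitions exactly
--    witness the unstable variables, those with f_i(x) ≠ x_i.
--  * Marking equation: for a set S of enabled transitions, firing S from
--    enc(x) yields enc(y) iff Δ(x,y) is exactly the set of variables touched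
--    by S.
--  * Canonical step: for a generalized asynchronous move x → y, the set
--    choosing one fixed enabled transition per variable of Δ(x,y) is a step.
--
-- Step semantics (iii) follows from the first two facts and the canonical
-- step; maximal steps (ii) add an exchange argument (a transition outside a
-- step whose variable is untouched can be added to it); atomic semantics (i)
-- is the case of firing a single transition.

open import Defs
open import Data.Nat using (ℕ)
open import Data.Fin using (Fin) renaming (_≟_ to _≟ᶠ_)
open import Data.Fin.Properties using (¬∀⟶∃¬)
open import Data.Bool using (Bool; true; false; not) renaming (_≟_ to _≟ᵇ_)
open import Data.Bool.Properties using (¬-not; not-¬)
open import Data.Product using (_×_; _,_; proj₁; proj₂; ∃)
open import Data.Sum using (_⊎_; inj₁; inj₂)
open import Data.Empty using (⊥; ⊥-elim)
open import Data.Maybe using (Maybe; just; nothing)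
open import Data.Maybe.Properties using (just-injective)
open import Data.List using (List; length; lookup)
open import Data.List.Relation.Unary.All as All using (All)
open import Data.List.Relation.Unary.Any as Any using (Any)
open import Data.List.Relation.Unary.Any.Properties using (lookup-index)
open import Data.List.Membership.Propositional using (_∈_; lose)
open import Data.List.Membership.Propositional.Properties using (∈-lookup)
open import Data.Vec.Functional using (updateAt)
open import Data.Vec.Functional.Properties using (updateAt-updates; updateAt-minimal)
open import Relation.Nullary using (¬_; Dec; yes; no)
open import Relation.Binary.PropositionalEquality
  using (_≡_; _≢_; refl; sym; trans; cong; subst)
open import Function using (id)
open import Function.Bundles using (_⇔_; mk⇔; Equivalence)
open import Function.Properties.Equivalence using () renaming (trans to ⇔-trans; sym to ⇔-sym)

open Equivalence using (to; from)

both-differ : ∀ {a b c : Bool} → b ≢ a → c ≢ a → b ≡ c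
both-differ b≢a c≢a = trans (¬-not b≢a) (sym (¬-not c≢a))

-- A deterministic choice of the position of a satisfying element of a list;
-- it lets us single out one transition per variable in a step.
chosenIndex : ∀ {A : Set} {P : A → Set} {xs : List A} →
  Dec (Any P xs) → Maybe (Fin (length xs))
chosenIndex (yes p) = just (Any.index p)
chosenIndex (no _)  = nothing

chosenIndex-sound : ∀ {A : Set} {P : A → Set} {xs : List A} (d : Dec (Any P xs)) {k} →
  chosenIndex d ≡ just k → P (lookup xs k)
chosenIndex-sound (yes p) refl = lookup-index p

chosenIndex-complete : ∀ {A : Set} {P : A → Set} {xs : List A} (d : Dec (Any P xs)) →
  Any P xs → ∃ λ k → chosenIndex d ≡ just k
chosenIndex-complete (yes p) _ = Any.index p , refl
chosenIndex-complete (no ¬p) p = ⊥-elim (¬p p)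

module _ (N : RPN) where
  open RPN N

  fire : Marking N → (Tr → Set) → Marking N
  fire M S p = (M p × ¬ (∃ λ t → S t × pre t p)) ⊎ (∃ λ t → S t × post t p)

  atomic⇔singletonFiring : ∀ {M M'} →
    AtomicStep N M M' ⇔ ∃ λ t → Enabled N M t × (_≐_ N M' (fire M (_≡ t)))
  atomic⇔singletonFiring {M} = mk⇔
    (λ (t , en , eq) → t , en , λ p → ⇔-trans (eq p) (singleton t p))
    (λ (t , en , eq) → t , en , λ p → ⇔-trans (eq p) (⇔-sym (singleton t p)))
    where
      singleton : ∀ t p → ((M p × ¬ pre t p) ⊎ post t p) ⇔ fire M (_≡ t) p
      singleton t p = mk⇔
        (λ { (inj₁ (m , ¬pre)) → inj₁ (m , λ { (_ , refl , pr) → ¬pre pr })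
           ; (inj₂ po) → inj₂ (t , refl , po) })
        (λ { (inj₁ (m , ¬pre)) → inj₁ (m , λ pr → ¬pre (t , refl , pr))
           ; (inj₂ (_ , refl , po)) → inj₂ po })

  extendStep : ∀ {M M' S} t → StepVia N M S M' → Enabled N M t →
    (∀ u → S u → ∀ p → pre u p → pre t p → ⊥) →
    StepVia N M (λ u → S u ⊎ u ≡ t) (fire M (λ u → S u ⊎ u ≡ t))
  extendStep {M} {S = S} t (_ , en , disj , _) en-t apart =
    (t , inj₂ refl) , en' , disj' , λ _ → mk⇔ id id
    where
      en' : ∀ u → S u ⊎ u ≡ t → Enabled N M u
      en' u (inj₁ s)    = en u s
      en' _ (inj₂ refl) = en-t
      disj' : ∀ u v → S u ⊎ u ≡ t → S v ⊎ v ≡ t → u ≢ v → ∀ p → pre u p → pre v p → ⊥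
      disj' u v (inj₁ su)   (inj₁ sv)   u≢v = disj u v su sv u≢v
      disj' u _ (inj₁ su)   (inj₂ refl) _   p pu pt = apart u su p pu pt
      disj' _ v (inj₂ refl) (inj₁ sv)   _   p pt pv = apart v sv p pv pt
      disj' _ _ (inj₂ refl) (inj₂ refl) t≢t = ⊥-elim (t≢t refl)

module Encoding {n} (f : BN n) (dnf : Fin n → Bool → DNF n) (isDNF : IsDNFChoice f dnf) where

  N : RPN
  N = encNet f dnf

  Tr : Set
  Tr = EncTr dnf

  enc : Config n → Marking N
  enc = encConfig

  var : Tr → Fin n
  var ((i , _) , _) = i

  val : Tr → Bool
  val ((_ , b) , _) = b

  clause : Tr → Clause n
  clause t = encClause {dnf = dnf} t

  clause-semantics : ∀ i b k (x : Config n) →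
    SatClause x (lookup (dnf i b) k) → x i ≡ b × f i x ≢ b
  clause-semantics i b k x sat = to (proj₁ isDNF i b x) (lose (∈-lookup k) sat)

  clause-consistent : ∀ i b k c → (i , c) ∈ lookup (dnf i b) k → (i , not c) ∈ lookup (dnf i b) k → ⊥
  clause-consistent i b k true  pos neg = All.lookup (proj₂ isDNF i b) (∈-lookup k) i pos neg
  clause-consistent i b k false neg pos = All.lookup (proj₂ isDNF i b) (∈-lookup k) i pos neg

  context-holds : ∀ x t → Enabled N (enc x) t →
    ∀ {j c} → (j , c) ∈ clause t → j ≢ var t → x j ≡ c
  context-holds x t en m j≢i = en _ (inj₂ (j≢i , m))

  -- The only literal on x_i that a clause of dnf i b can contain is x_i = b:
  -- were x_i = ¬b in it, flipping x_i in an enabling configuration would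
  -- satisfy the clause while x_i ≠ b, contradicting the DNF semantics.
  own-literal : ∀ x t → Enabled N (enc x) t → ∀ {c} → (var t , c) ∈ clause t → c ≡ val t
  own-literal x t@((i , b) , k) en {c} m with c ≟ᵇ b
  ... | yes c≡b = c≡b
  ... | no  c≢b = ⊥-elim (not-¬ refl (trans (sym (proj₁ (clause-semantics i b k z z-sat))) z-i))
    where
      xi≡b : x i ≡ b
      xi≡b = en (i , b) (inj₁ refl)
      z : Config n
      z = updateAt x i not
      z-i : z i ≡ not b
      z-i = trans (updateAt-updates i x) (cong not xi≡b)
      z-lit : ∀ {l} → l ∈ clause t → SatLit z l
      z-lit {j , c'} m' with j ≟ᶠ i
      ... | no j≢i  = trans (updateAt-minimal j i x j≢i) (context-holds x t en m' j≢i)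
      ... | yes refl with c' ≟ᵇ b
      ...   | no  c'≢b = trans z-i (sym (¬-not c'≢b))
      ...   | yes refl = ⊥-elim (clause-consistent i b k c' m'
                           (subst (λ d → (i , d) ∈ clause t) (¬-not c≢b) m))
      z-sat : SatClause z (clause t)
      z-sat = All.tabulate z-lit

  enabled⇔ : ∀ x t → Enabled N (enc x) t ⇔ (x (var t) ≡ val t × SatClause x (clause t))
  enabled⇔ x t@((i , b) , k) = mk⇔
    (λ en → en (i , b) (inj₁ refl) , All.tabulate (λ m → lit en m))
    (λ { (xi≡b , _)   _ (inj₁ refl)     → xi≡b
       ; (_    , sat) _ (inj₂ (_ , m)) → All.lookup sat m })
    where
      lit : Enabled N (enc x) t → ∀ {l} → l ∈ clause t → SatLit x l
      lit en {j , c} m with j ≟ᶠ i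
      ... | no  j≢i  = context-holds x t en m j≢i
      ... | yes refl = trans (en (i , b) (inj₁ refl)) (sym (own-literal x t en m))

  enabled⇒unstable : ∀ x t → Enabled N (enc x) t → f (var t) x ≢ x (var t)
  enabled⇒unstable x t@((i , b) , k) en with to (enabled⇔ x t) en
  ... | refl , sat = proj₂ (clause-semantics i b k x sat)

  selected : (x : Config n) → ∀ i b → Maybe (Fin (length (dnf i b)))
  selected x i b = chosenIndex (Any.any? (λ C → All.all? (λ (j , c) → x j ≟ᵇ c) C) (dnf i b))

  selected-enabled : ∀ x i b k → selected x i b ≡ just k → x i ≡ b → Enabled N (enc x) ((i , b) , k)
  selected-enabled x i b k sel xi≡b = from (enabled⇔ x ((i , b) , k)) (xi≡b , chosenIndex-sound _ sel)

  selected-exists : ∀ x i → f i x ≢ x i → ∃ λ k → selected x i (x i) ≡ just k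
  selected-exists x i unstable = chosenIndex-complete _ (from (proj₁ isDNF i (x i) x) (refl , unstable))

  Touches : (Tr → Set) → Fin n → Set
  Touches S j = ∃ λ t → S t × var t ≡ j

  touches-singleton : ∀ t j → Touches (_≡ t) j ⇔ var t ≡ j
  touches-singleton t j = mk⇔ (λ { (_ , refl , e) → e }) (λ e → t , refl , e)

  marking-equation : ∀ x y S → (∀ t → S t → Enabled N (enc x) t) →
    _≐_ N (enc y) (fire N (enc x) S) ⇔ (∀ j → j ∈Δ x , y ⇔ Touches S j)
  marking-equation x y S en = mk⇔ Δ-touched (λ Δ⇔ p → mk⇔ (reached Δ⇔ p) (reached⁻¹ Δ⇔ p))
    where
      reads : ∀ t → S t → x (var t) ≡ val t
      reads t s = proj₁ (to (enabled⇔ x t) (en t s))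

      Δ-touched : _≐_ N (enc y) (fire N (enc x) S) → ∀ j → j ∈Δ x , y ⇔ Touches S j
      Δ-touched eq j = mk⇔ touched differs
        where
          touched : j ∈Δ x , y → Touches S j
          touched d with to (eq (j , y j)) refl
          ... | inj₁ (x≡y , _)  = ⊥-elim (d x≡y)
          ... | inj₂ (t , s , p) = t , s , sym (cong proj₁ p)
          differs : Touches S j → j ∈Δ x , y
          differs (t@((i , b) , k) , s , refl) x≡y =
            not-¬ refl (trans (sym (reads t s)) (trans x≡y (from (eq (i , not b)) (inj₂ (t , s , refl)))))

      reached : (∀ j → j ∈Δ x , y ⇔ Touches S j) → ∀ p → enc y p → fire N (enc x) S p
      reached Δ⇔ (j , c) y≡c with x j ≟ᵇ y j
      ... | yes x≡y = inj₁ (trans x≡y y≡c , λ { (t , s , refl) → from (Δ⇔ j) (t , s , refl) x≡y })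
      ... | no  d with to (Δ⇔ j) d
      ...   | t , s , refl =
                inj₂ (t , s , cong (j ,_) (trans (sym y≡c) (trans (¬-not (λ e → d (sym e))) (cong not (reads t s)))))

      reached⁻¹ : (∀ j → j ∈Δ x , y ⇔ Touches S j) → ∀ p → fire N (enc x) S p → enc y p
      reached⁻¹ Δ⇔ (j , c) (inj₁ (x≡c , untouched)) with x j ≟ᵇ y j
      ... | yes x≡y = trans (sym x≡y) x≡c
      ... | no  d with to (Δ⇔ j) d
      ...   | t , s , refl = ⊥-elim (untouched (t , s , cong (j ,_) (trans (sym x≡c) (reads t s))))
      reached⁻¹ Δ⇔ (j , c) (inj₂ (t , s , refl)) =
        trans (¬-not (λ e → from (Δ⇔ j) (t , s , refl) (sym e))) (cong not (reads t s))

  changed-unstable : ∀ {x y} → GenStep f x y → ∀ j → j ∈Δ x , y → f j x ≢ x j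
  changed-unstable (_ , update) j d f≡x = d (trans (sym f≡x) (sym (update j d)))

  touching⇒gen : ∀ x y S → (∃ λ t → S t) → (∀ t → S t → Enabled N (enc x) t) →
    (∀ j → j ∈Δ x , y ⇔ Touches S j) → GenStep f x y
  touching⇒gen x y S (t , s) en Δ⇔ =
    (λ x≡y → from (Δ⇔ (var t)) (t , s , refl) (x≡y (var t))) , update
    where
      update : ∀ j → j ∈Δ x , y → y j ≡ f j x
      update j d with to (Δ⇔ j) d
      ... | u , su , refl = both-differ (λ e → d (sym e)) (enabled⇒unstable x u (en u su))

  step⇒gen : ∀ {x y S} → StepVia N (enc x) S (enc y) → GenStep f x y
  step⇒gen {x} {y} {S} (nonempty , en , _ , eq) =
    touching⇒gen x y S nonempty en (to (marking-equation x y S en) eq)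

  Canonical : Config n → Config n → Tr → Set
  Canonical x y ((i , b) , k) = i ∈Δ x , y × x i ≡ b × selected x i b ≡ just k

  canonical-enabled : ∀ x y t → Canonical x y t → Enabled N (enc x) t
  canonical-enabled x y ((i , b) , k) (_ , xi≡b , sel) = selected-enabled x i b k sel xi≡b

  -- one canonical transition per place, so presets are disjoint
  canonical-disjoint : ∀ x y t u → Canonical x y t → Canonical x y u → t ≢ u →
    ∀ p → p ≡ proj₁ t → p ≡ proj₁ u → ⊥
  canonical-disjoint x y ((i , b) , k) _ (_ , _ , sel) (_ , _ , sel') t≢u _ refl refl =
    t≢u (cong ((i , b) ,_) (just-injective (trans (sym sel) sel')))

  module _ {x y : Config n} (g : GenStep f x y) where

    canonical-of : ∀ j → j ∈Δ x , y → ∃ λ k → Canonical x y ((j , x j) , k)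
    canonical-of j d with selected-exists x j (changed-unstable g j d)
    ... | k , sel = k , d , refl , sel

    canonical-touches : ∀ j → j ∈Δ x , y ⇔ Touches (Canonical x y) j
    canonical-touches j = mk⇔
      (λ d → _ , proj₂ (canonical-of j d) , refl)
      (λ { (((i , b) , k) , (d , _) , refl) → d })

    canonical-step : StepVia N (enc x) (Canonical x y) (enc y)
    canonical-step =
      (_ , proj₂ (canonical-of j d)) , canonical-enabled x y , canonical-disjoint x y ,
      from (marking-equation x y (Canonical x y) (canonical-enabled x y)) canonical-touches
      where
        changed : ∃ λ j → j ∈Δ x , y
        changed = ¬∀⟶∃¬ n (λ j → x j ≡ y j) (λ j → x j ≟ᵇ y j) (proj₁ g)
        j : Fin n
        j = proj₁ changed
        d : j ∈Δ x , y
        d = proj₂ changed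

  gen⇔step : ∀ x y → GenStep f x y ⇔ Step N (enc x) (enc y)
  gen⇔step x y = mk⇔ (λ g → Canonical x y , canonical-step g) (λ (_ , sv) → step⇒gen sv)

  -- In a synchronous move every unstable variable changes, so any enabled
  -- transition outside the canonical step shares its place with a canonical one.
  sync⇒maxStep : ∀ x y → SyncStep f x y → MaxStep N (enc x) (enc y)
  sync⇒maxStep x y (x≠y , update) = Canonical x y , canonical-step g , no-extension
    where
      g : GenStep f x y
      g = x≠y , λ i _ → update i

      unstable-changes : ∀ i → f i x ≢ x i → i ∈Δ x , y
      unstable-changes i unstable x≡y = unstable (trans (sym (update i)) (sym x≡y))

      clash : ∀ S' {M''} → (∀ t → Canonical x y t → S' t) → StepVia N (enc x) S' M'' → ∀ i k →
        S' ((i , x i) , k) → ¬ Canonical x y ((i , x i) , k) → ⊥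
      clash S' sub (_ , en' , disj' , _) i k s' ¬can
        with canonical-of g i (unstable-changes i (enabled⇒unstable x _ (en' _ s')))
      ... | k₀ , can₀ with k ≟ᶠ k₀
      ...   | yes refl = ¬can can₀
      ...   | no  k≢k₀ = disj' _ _ s' (sub _ can₀) (λ { refl → k≢k₀ refl }) (i , x i) refl refl

      no-extension : ¬ (∃ λ S' → (∀ t → Canonical x y t → S' t) × (∃ λ t → S' t × ¬ Canonical x y t)
                               × (∃ λ M'' → StepVia N (enc x) S' M''))
      no-extension (S' , sub , (((i , b) , k) , s' , ¬can) , _ , sv')
        with proj₁ (proj₂ sv') _ s' (i , b) (inj₁ refl)  -- enabledness gives x i ≡ b
      ... | refl = clash S' sub sv' i k s' ¬can

  -- A maximal step leaves no unstable variable unchanged: its selected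
  -- transition could be added to the step.
  maxStep⇒sync : ∀ x y → MaxStep N (enc x) (enc y) → SyncStep f x y
  maxStep⇒sync x y (S , sv@(_ , en , _ , eq) , maximal) = proj₁ g , settled
    where
      g : GenStep f x y
      g = step⇒gen sv
      Δ⇔ : ∀ j → j ∈Δ x , y ⇔ Touches S j
      Δ⇔ = to (marking-equation x y S en) eq

      extend : ∀ i → x i ≡ y i → f i x ≢ x i → ⊥
      extend i x≡y unstable with selected-exists x i unstable
      ... | k , sel =
        maximal ((λ u → S u ⊎ u ≡ t₀) , (λ _ → inj₁) , (t₀ , inj₂ refl , t₀∉S) , _ ,
                 extendStep N t₀ sv (selected-enabled x i (x i) k sel refl) apart)
        where
          t₀ : Tr
          t₀ = (i , x i) , k
          untouched : ¬ Touches S i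
          untouched tch = from (Δ⇔ i) tch x≡y
          t₀∉S : ¬ S t₀
          t₀∉S s = untouched (t₀ , s , refl)
          apart : ∀ u → S u → ∀ p → p ≡ proj₁ u → p ≡ proj₁ t₀ → ⊥
          apart u s _ refl q = untouched (u , s , cong proj₁ q)

      settled : ∀ i → y i ≡ f i x
      settled i with x i ≟ᵇ y i
      ... | no  d = proj₂ g i d
      ... | yes x≡y with f i x ≟ᵇ x i
      ...   | yes f≡x  = trans (sym x≡y) (sym f≡x)
      ...   | no  f≢x = ⊥-elim (extend i x≡y f≢x)

  sync⇔maxStep : ∀ x y → SyncStep f x y ⇔ MaxStep N (enc x) (enc y)
  sync⇔maxStep x y = mk⇔ (sync⇒maxStep x y) (maxStep⇒sync x y)

  SingletonFiring : Config n → Config n → Set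
  SingletonFiring x y = ∃ λ t → Enabled N (enc x) t × (_≐_ N (enc y) (fire N (enc x) (_≡ t)))

  async⇔singletonFiring : ∀ x y → AsyncStep f x y ⇔ SingletonFiring x y
  async⇔singletonFiring x y = mk⇔ async⇒firing firing⇒async
    where
      singleton-enabled : ∀ {t} → Enabled N (enc x) t → ∀ u → u ≡ t → Enabled N (enc x) u
      singleton-enabled en _ refl = en

      async⇒firing : AsyncStep f x y → SingletonFiring x y
      async⇒firing (i , d , only , y≡f) =
        t₀ , en₀ , from (marking-equation x y (_≡ t₀) (singleton-enabled en₀)) Δ⇔
        where
          unstable : f i x ≢ x i
          unstable f≡x = d (trans (sym f≡x) (sym y≡f))
          t₀ : Tr
          t₀ = (i , x i) , proj₁ (selected-exists x i unstable)
          en₀ : Enabled N (enc x) t₀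
          en₀ = selected-enabled x i (x i) _ (proj₂ (selected-exists x i unstable)) refl
          Δ⇔ : ∀ j → j ∈Δ x , y ⇔ Touches (_≡ t₀) j
          Δ⇔ j = mk⇔ (λ dj → from (touches-singleton t₀ j) (sym (only j dj)))
                     (λ tch → subst (λ j → j ∈Δ x , y) (to (touches-singleton t₀ j) tch) d)

      firing⇒async : SingletonFiring x y → AsyncStep f x y
      firing⇒async (t , en , eq) =
        var t , d , only , both-differ (λ e → d (sym e)) (enabled⇒unstable x t en)
        where
          Δ⇔ : ∀ j → j ∈Δ x , y ⇔ Touches (_≡ t) j
          Δ⇔ = to (marking-equation x y (_≡ t) (singleton-enabled en)) eq
          d : var t ∈Δ x , y
          d = from (Δ⇔ (var t)) (t , refl , refl)
          only : ∀ j → j ∈Δ x , y → j ≡ var t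
          only j dj = sym (to (touches-singleton t j) (to (Δ⇔ j) dj))

theorem1 : (n : ℕ) (f : BN n) (dnf : Fin n → Bool → DNF n) → IsDNFChoice f dnf →
    (x y : Config n) →
      (AsyncStep f x y ⇔ AtomicStep (encNet f dnf) (encConfig x) (encConfig y))
    × (SyncStep f x y ⇔ MaxStep (encNet f dnf) (encConfig x) (encConfig y))
    × (GenStep f x y ⇔ Step (encNet f dnf) (encConfig x) (encConfig y))
theorem1 n f dnf isDNF x y =
    ⇔-trans (async⇔singletonFiring x y) (⇔-sym (atomic⇔singletonFiring (encNet f dnf)))
  , sync⇔maxStep x y
  , gen⇔step x y
  where open Encoding f dnf isDNF
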